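{- Let $\mathbf{w}$ be an infinite binary word which avoids $(5/2)^+$-powers. Then at least 3 of the words in $C=\{0010,0100,1011,1101\}$ are factors of $\mathbf{w}$.
   Context: For a finite word of length $\ell$ with smallest period $p$, its exponent is $\ell/p$; a $(5/2)^+$-power is a word of exponent $>5/2$; a word avoids $(5/2)^+$-powers if none of its factors is a $(5/2)^+$-power. -}

module Defs where

open import Data.Nat using (ℕ; zero; suc; _+_; _*_; _<_; _≤_)
open import Data.Bool using (Bool; true; false)
open import Data.Fin using (Fin)
open import Data.Product using (Σ; ∃; _×_; _,_)
open import Relation.Binary.PropositionalEquality using (_≡_; _≢_)
open import Relation.Nullary using (¬_)

-- Binary alphabet: false = 0, true = 1.
-- An infinite binary word.
InfWord : Set
InfWord = ℕ → Bool

IsPeriod : InfWord → (i ℓ p : ℕ) → Set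
IsPeriod w i ℓ p = (1 ≤ p) × (∀ j → j + p < ℓ → w (i + j) ≡ w (i + (j + p)))

IsSmallestPeriod : InfWord → (i ℓ p : ℕ) → Set
IsSmallestPeriod w i ℓ p = IsPeriod w i ℓ p × (∀ q → IsPeriod w i ℓ q → p ≤ q)

-- The factor w[i .. i+ℓ) (with ℓ ≥ 1) is a (5/2)^+-power: its exponent
-- ℓ/p exceeds 5/2, where p is its smallest period, i.e. 5 p < 2 ℓ.
Is52PlusPowerAt : InfWord → (i ℓ : ℕ) → Set
Is52PlusPowerAt w i ℓ = (1 ≤ ℓ) × ∃ λ p → IsSmallestPeriod w i ℓ p × (5 * p < 2 * ℓ)

Avoids52Plus : InfWord → Set
Avoids52Plus w = ∀ i ℓ → ¬ Is52PlusPowerAt w i ℓ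

IsFactor : ∀ {n} → (Fin n → Bool) → InfWord → Set
IsFactor {n} u w = ∃ λ i → ∀ (j : Fin n) → w (i + Data.Fin.toℕ j) ≡ u j

word4 : Bool → Bool → Bool → Bool → Fin 4 → Bool
word4 a b c d Fin.zero = a
word4 a b c d (Fin.suc Fin.zero) = b
word4 a b c d (Fin.suc (Fin.suc Fin.zero)) = c
word4 a b c d (Fin.suc (Fin.suc (Fin.suc Fin.zero))) = d

C : Fin 4 → (Fin 4 → Bool)
C Fin.zero = word4 false false true false
C (Fin.suc Fin.zero) = word4 false true false false
C (Fin.suc (Fin.suc Fin.zero)) = word4 true false true true
C (Fin.suc (Fin.suc (Fin.suc Fin.zero))) = word4 true true false true

{-# OPTIONS --safe #-}
module Submission where

-- Backtracking search over the prefixes of w.  A branch is closed as soon as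
-- the prefix ends in a (5/2)^+-power (impossible for w) or already contains
-- three words of C.  Every branch closes within 45 letters, which the type
-- checker verifies by evaluation.  Soundness only needs the two closing tests
-- to be correct: the suffix of length p + L of a prefix x has period p exactly
-- when L ≤ lcp (x reversed) (x reversed without its first p letters), and its
-- exponent exceeds 5/2 iff 3 p < 2 L; a period of a factor is turned into a
-- smallest one by bounded minimisation.

open import Defs
open import Data.Fin using (Fin; toℕ)
open import Data.Product using (∃; _×_; _,_; proj₁; proj₂)
open import Relation.Binary.PropositionalEquality using (_≢_)

open import Data.Bool using (Bool; true; false; T; _∧_; _∨_)
open import Data.Bool.Properties using (T-∧; T-∨; T-≡) renaming (_≟_ to _≟ᵇ_)
open import Data.Empty using (⊥-elim)
open import Data.Fin.Properties using (all?; any?) renaming (_≟_ to _≟ᶠ_)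
open import Data.Fin.Subset using (Subset; _∈_; _∪_) renaming (⊥ to ∅)
open import Data.Fin.Subset.Properties using (_∈?_; ∉⊥; x∈p∪q⁻)
open import Data.List using (List; []; _∷_; drop; length)
open import Data.Nat using (ℕ; zero; suc; _+_; _*_; _≤_; _<_; s≤s; s≤s⁻¹; z≤n; _≤?_; _<?_)
open import Data.Nat.Induction using (<-rec)
open import Data.Nat.Properties
  using ( allUpTo?; anyUpTo?; ≤-refl; ≤-trans; ≤-<-trans; <⇒≤; ≮⇒≥; m+n≤o⇒m≤o; m≤n+m
        ; m≤n⇒∃[o]m+o≡n; +-comm; +-cancelʳ-<; +-monoʳ-<; *-monoʳ-≤)
open import Data.Nat.Tactic.RingSolver using (solve)
open import Data.Sum using (inj₁; inj₂; [_,_]′)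
open import Data.Vec using (tabulate)
open import Data.Vec.Properties using (lookup∘tabulate; []=⇒lookup)
open import Function using (_∘_)
open import Function.Bundles using (Equivalence)
open import Relation.Binary.PropositionalEquality using (_≡_; refl; sym; trans; cong; subst; subst₂)
open import Relation.Nullary using (Dec; yes; no)
open import Relation.Nullary.Decidable using (isYes; ¬?; _×-dec_; _→-dec_; map′; toWitness)
open import Relation.Unary using (Pred; Decidable)

open Equivalence using (to; from)

module _ (w : InfWord) (i ℓ : ℕ) where

  isPeriod? : ∀ p → Dec (IsPeriod w i ℓ p)
  isPeriod? p =
    (1 ≤? p) ×-dec map′ (λ h j j+p<ℓ → h (m+n≤o⇒m≤o (suc j) j+p<ℓ) j+p<ℓ) (λ h {j} _ → h j)
                        (allUpTo? (λ j → (j + p <? ℓ) →-dec (w (i + j) ≟ᵇ w (i + (j + p)))) ℓ)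

  smallestPeriod : ∀ p → IsPeriod w i ℓ p → ∃ λ q → q ≤ p × IsSmallestPeriod w i ℓ q
  smallestPeriod = <-rec _ minimise
    where
    minimise : ∀ p → (∀ {q} → q < p → IsPeriod w i ℓ q → ∃ λ r → r ≤ q × IsSmallestPeriod w i ℓ r) →
               IsPeriod w i ℓ p → ∃ λ q → q ≤ p × IsSmallestPeriod w i ℓ q
    minimise p rec per with anyUpTo? isPeriod? p
    ... | yes (q , q<p , perq) = let r , r≤q , min = rec q<p perq in r , ≤-trans r≤q (<⇒≤ q<p) , min
    ... | no noSmaller = p , ≤-refl , per , λ q perq → ≮⇒≥ λ q<p → noSmaller (q , q<p , perq)

periodic⇒52PlusPower : ∀ w i ℓ p → IsPeriod w i ℓ p → 5 * p < 2 * ℓ → Is52PlusPowerAt w i ℓ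
periodic⇒52PlusPower w i zero    p _   ()
periodic⇒52PlusPower w i (suc ℓ) p per 5p<2ℓ =
  let q , q≤p , smallest = smallestPeriod w i (suc ℓ) p per
  in s≤s z≤n , q , smallest , ≤-<-trans (*-monoʳ-≤ 5 q≤p) 5p<2ℓ

3p<2L⇒5p<2[p+L] : ∀ p L → 3 * p < 2 * L → 5 * p < 2 * (p + L)
3p<2L⇒5p<2[p+L] p L 3p<2L = subst₂ _<_ lhs rhs (+-monoʳ-< (2 * p) 3p<2L)
  where
  lhs : 2 * p + 3 * p ≡ 5 * p
  lhs = solve (p ∷ [])
  rhs : 2 * p + 2 * L ≡ 2 * (p + L)
  rhs = solve (p ∷ L ∷ [])

lcp : List Bool → List Bool → ℕ
lcp (x ∷ xs) (y ∷ ys) with x ≟ᵇ y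
... | yes _ = suc (lcp xs ys)
... | no  _ = 0
lcp _ _ = 0

lcp-≤-length : ∀ xs ys → lcp xs ys ≤ length ys
lcp-≤-length []       ys       = z≤n
lcp-≤-length (x ∷ xs) []       = z≤n
lcp-≤-length (x ∷ xs) (y ∷ ys) with x ≟ᵇ y
... | yes _ = s≤s (lcp-≤-length xs ys)
... | no  _ = z≤n

ThreeDistinct : ∀ {p} → Pred (Fin 4) p → Set p
ThreeDistinct P = ∃ λ a → ∃ λ b → ∃ λ c → (a ≢ b) × (a ≢ c) × (b ≢ c) × P a × P b × P c

ThreeDistinct-map : ∀ {p q} {P : Pred (Fin 4) p} {Q : Pred (Fin 4) q} →
                    (∀ {x} → P x → Q x) → ThreeDistinct P → ThreeDistinct Q
ThreeDistinct-map f (a , b , c , a≢b , a≢c , b≢c , Pa , Pb , Pc) =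
  a , b , c , a≢b , a≢c , b≢c , f Pa , f Pb , f Pc

threeDistinct? : ∀ {p} {P : Pred (Fin 4) p} → Decidable P → Dec (ThreeDistinct P)
threeDistinct? P? = any? λ a → any? λ b → any? λ c →
  ¬? (a ≟ᶠ b) ×-dec ¬? (a ≟ᶠ c) ×-dec ¬? (b ≟ᶠ c) ×-dec P? a ×-dec P? b ×-dec P? c

∈-tabulate-isYes : ∀ {n p} {P : Pred (Fin n) p} (P? : Decidable P) {x} → x ∈ tabulate (isYes ∘ P?) → P x
∈-tabulate-isYes P? {x} x∈ =
  toWitness {a? = P? x} (from T-≡ (trans (sym (lookup∘tabulate (isYes ∘ P?) x)) ([]=⇒lookup x∈)))

T-∧-select : ∀ (f : Bool → Bool) x → T (f false ∧ f true) → T (f x)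
T-∧-select f false h = proj₁ (to (T-∧ {f false} {f true}) h)
T-∧-select f true  h = proj₂ (to (T-∧ {f false} {f true}) h)

-- The search works on prefixes written backwards, most recent letter first.

powerSuffix? : (xs : List Bool) → Dec (∃ λ p → p < length xs × 3 * suc p < 2 * lcp xs (drop (suc p) xs))
powerSuffix? xs = anyUpTo? (λ p → 3 * suc p <? 2 * lcp xs (drop (suc p) xs)) (length xs)

ending : List Bool → Subset 4
ending (d ∷ c ∷ b ∷ a ∷ _) = tabulate λ x → isYes (all? λ j → C x j ≟ᵇ word4 a b c d j)
ending _                   = ∅

settled : Subset 4 → List Bool → Bool
settled S xs = isYes (powerSuffix? xs) ∨ isYes (threeDistinct? (_∈? S))

-- S collects the words of C seen so far; the result is true when every way
-- of extending xs by at most fuel letters leads to a settled node.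
backtrack : ℕ → Subset 4 → List Bool → Bool
backtrack zero       S xs = settled S xs
backtrack (suc fuel) S xs = settled S xs ∨ (child false ∧ child true)
  where
  child : Bool → Bool
  child x = backtrack fuel (S ∪ ending (x ∷ xs)) (x ∷ xs)

backtrack-succeeds : backtrack 45 ∅ [] ≡ true
backtrack-succeeds = refl

module _ (w : InfWord) where

  reversePrefix : ℕ → List Bool
  reversePrefix zero    = []
  reversePrefix (suc n) = w n ∷ reversePrefix n

  length-reversePrefix : ∀ n → length (reversePrefix n) ≡ n
  length-reversePrefix zero    = refl
  length-reversePrefix (suc n) = cong suc (length-reversePrefix n)

  drop-reversePrefix : ∀ p m → drop p (reversePrefix (p + m)) ≡ reversePrefix m
  drop-reversePrefix zero    m = refl
  drop-reversePrefix (suc p) m = drop-reversePrefix p m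

  lcp-≤-reversePrefix : ∀ xs m → lcp xs (reversePrefix m) ≤ m
  lcp-≤-reversePrefix xs m =
    subst (lcp xs (reversePrefix m) ≤_) (length-reversePrefix m) (lcp-≤-length xs (reversePrefix m))

  lcp-reversePrefix : ∀ k a b → k < lcp (reversePrefix (suc k + a)) (reversePrefix (suc k + b)) → w a ≡ w b
  lcp-reversePrefix k a b k<lcp with w (k + a) ≟ᵇ w (k + b)
  lcp-reversePrefix zero    a b _     | yes wa≡wb = wa≡wb
  lcp-reversePrefix (suc k) a b k<lcp | yes _     = lcp-reversePrefix k a b (s≤s⁻¹ k<lcp)
  lcp-reversePrefix k       a b ()    | no  _

  lcp-agree : ∀ {p} i L j → j < L → L ≤ lcp (reversePrefix (p + (L + i))) (reversePrefix (L + i)) →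
              w (i + j) ≡ w (i + (j + p))
  lcp-agree {p} i L j j<L L≤lcp with m≤n⇒∃[o]m+o≡n j<L
  ... | k , refl = sym (lcp-reversePrefix k (i + (j + p)) (i + j)
                          (subst₂ (λ m n → k < lcp (reversePrefix m) (reversePrefix n)) far near k<lcp))
    where
    k<lcp : k < lcp (reversePrefix (p + (suc j + k + i))) (reversePrefix (suc j + k + i))
    k<lcp = ≤-trans (s≤s (m≤n+m k j)) L≤lcp
    far : p + (suc j + k + i) ≡ suc k + (i + (j + p))
    far = solve (p ∷ j ∷ k ∷ i ∷ [])
    near : suc j + k + i ≡ suc k + (i + j)
    near = solve (j ∷ k ∷ i ∷ [])

  lcp-isPeriod : ∀ {p} i L → 1 ≤ p → L ≤ lcp (reversePrefix (p + (L + i))) (reversePrefix (L + i)) →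
                 IsPeriod w i (p + L) p
  lcp-isPeriod {p} i L 1≤p L≤lcp = 1≤p , λ j j+p<p+L →
    lcp-agree i L j (+-cancelʳ-< p j L (subst (j + p <_) (+-comm p L) j+p<p+L)) L≤lcp

  lcp-52PlusPower : ∀ p m → 1 ≤ p → 3 * p < 2 * lcp (reversePrefix (p + m)) (reversePrefix m) →
                    ∃ λ i → ∃ λ ℓ → Is52PlusPowerAt w i ℓ
  lcp-52PlusPower p m 1≤p 3p<2L with m≤n⇒∃[o]m+o≡n (lcp-≤-reversePrefix (reversePrefix (p + m)) m)
  ... | i , L+i≡m =
    i , p + L , periodic⇒52PlusPower w i (p + L) p (lcp-isPeriod i L 1≤p L≤lcp) (3p<2L⇒5p<2[p+L] p L 3p<2L)
    where
    L = lcp (reversePrefix (p + m)) (reversePrefix m)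
    L≤lcp : L ≤ lcp (reversePrefix (p + (L + i))) (reversePrefix (L + i))
    L≤lcp = subst (λ n → L ≤ lcp (reversePrefix (p + n)) (reversePrefix n)) (sym L+i≡m) ≤-refl

  powerSuffix⇒52PlusPower : ∀ n → T (isYes (powerSuffix? (reversePrefix n))) →
                            ∃ λ i → ∃ λ ℓ → Is52PlusPowerAt w i ℓ
  powerSuffix⇒52PlusPower n h with toWitness {a? = powerSuffix? (reversePrefix n)} h
  ... | p , p<n , 3p<2L with m≤n⇒∃[o]m+o≡n (subst (p <_) (length-reversePrefix n) p<n)
  ...   | m , refl = lcp-52PlusPower (suc p) m (s≤s z≤n)
    (subst (λ ys → 3 * suc p < 2 * lcp (reversePrefix (suc p + m)) ys) (drop-reversePrefix (suc p) m) 3p<2L)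

  window : ∀ i (j : Fin 4) → w (toℕ j + i) ≡ word4 (w i) (w (1 + i)) (w (2 + i)) (w (3 + i)) j
  window i Fin.zero                               = refl
  window i (Fin.suc Fin.zero)                     = refl
  window i (Fin.suc (Fin.suc Fin.zero))           = refl
  window i (Fin.suc (Fin.suc (Fin.suc Fin.zero))) = refl

  ending-isFactor : ∀ n {x} → x ∈ ending (reversePrefix n) → IsFactor (C x) w
  ending-isFactor (suc (suc (suc (suc i)))) x∈ =
    i , λ j → trans (cong w (+-comm i (toℕ j))) (trans (window i j) (sym (∈-tabulate-isYes spells? x∈ j)))
    where
    spells? = λ y → all? λ j → C y j ≟ᵇ word4 (w i) (w (1 + i)) (w (2 + i)) (w (3 + i)) j
  ending-isFactor 0 x∈ = ⊥-elim (∉⊥ x∈)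
  ending-isFactor 1 x∈ = ⊥-elim (∉⊥ x∈)
  ending-isFactor 2 x∈ = ⊥-elim (∉⊥ x∈)
  ending-isFactor 3 x∈ = ⊥-elim (∉⊥ x∈)

  Witnessed : Subset 4 → Set
  Witnessed S = ∀ {x} → x ∈ S → IsFactor (C x) w

  Witnessed-step : ∀ n S → Witnessed S → Witnessed (S ∪ ending (reversePrefix (suc n)))
  Witnessed-step n S seen x∈ with x∈p∪q⁻ S (ending (reversePrefix (suc n))) x∈
  ... | inj₁ x∈S = seen x∈S
  ... | inj₂ x∈E = ending-isFactor (suc n) x∈E

module Soundness (w : InfWord) (avoids : Avoids52Plus w) where

  settled-sound : ∀ n S → Witnessed w S → T (settled S (reversePrefix w n)) →
                  ThreeDistinct (λ a → IsFactor (C a) w)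
  settled-sound n S seen h =
    [ (λ power → let i , ℓ , i-ℓ-power = powerSuffix⇒52PlusPower w n power in ⊥-elim (avoids i ℓ i-ℓ-power))
    , ThreeDistinct-map seen ∘ toWitness {a? = threeDistinct? (_∈? S)}
    ]′ (to (T-∨ {isYes (powerSuffix? (reversePrefix w n))} {isYes (threeDistinct? (_∈? S))}) h)

  backtrack-sound : ∀ fuel n S → Witnessed w S → T (backtrack fuel S (reversePrefix w n)) →
                    ThreeDistinct (λ a → IsFactor (C a) w)
  backtrack-sound zero       n S seen h = settled-sound n S seen h
  backtrack-sound (suc fuel) n S seen h =
    [ settled-sound n S seen
    , backtrack-sound fuel (suc n) _ (Witnessed-step w n S seen) ∘ T-∧-select child (w n)
    ]′ (to (T-∨ {settled S (reversePrefix w n)} {child false ∧ child true}) h)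
    where
    child : Bool → Bool
    child x = backtrack fuel (S ∪ ending (x ∷ reversePrefix w n)) (x ∷ reversePrefix w n)

  -- Stated for the literal [] so that backtrack-succeeds is matched
  -- syntactically; unifying with reversePrefix w 0 would rerun the search.
  backtrack-sound-[] : ∀ fuel → backtrack fuel ∅ [] ≡ true → ThreeDistinct (λ a → IsFactor (C a) w)
  backtrack-sound-[] fuel = backtrack-sound fuel 0 ∅ (⊥-elim ∘ ∉⊥) ∘ from T-≡

lemma2 : (w : InfWord) → Avoids52Plus w →
    ∃ λ (a : Fin 4) → ∃ λ (b : Fin 4) → ∃ λ (c : Fin 4) →
      (a ≢ b) × (a ≢ c) × (b ≢ c) ×
      IsFactor (C a) w × IsFactor (C b) w × IsFactor (C c) w
lemma2 w avoids = Soundness.backtrack-sound-[] w avoids 45 backtrack-succeeds
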